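{- Let $i=\sqrt{ -1}$. For every rational number $\alpha$, $\mathcal{R}_\alpha(i),\mathcal{S}_\alpha(i)\in\{0,\pm1,\pm i,\pm(1+i),\pm(1-i)\}$, and the remainder of $\mathcal{S}_\alpha(q)$ upon division by $q^2+1$ is $aq+b$ for some $a,b\in\{0,\pm1\}$.
   Context: For an integer $c$, $[c]_q=\frac{1-q^c}{1-q}$. Every rational $\alpha>1$ has a unique negative continued fraction expansion $\alpha=c_1-\cfrac{1}{c_2-\cfrac{1}{\ddots-\cfrac{1}{c_l}}}$ with integers $c_j\ge 2$. Put $M^-_q(c)=\begin{pmatrix}[c]_q & -q^{c-1}\\ 1 & 0\end{pmatrix}$ and define $\mathcal{R}_\alpha(q),\mathcal{S}_\alpha(q)$ by $\begin{pmatrix}\mathcal{R}_\alpha(q)\\ \mathcal{S}_\alpha(q)\end{pmatrix}=M^-_q(c_1)\cdots M^-_q(c_l)\begin{pmatrix}1\\0\end{pmatrix}$. For rational $\alpha\le 1$ they are defined recursively by $\mathcal{S}_\alpha(q)=\mathcal{S}_{\alpha+1}(q)$ and $\mathcal{R}_\alpha(q)=q^{ -1}(\mathcal{R}_{\alpha+1}(q)-\mathcal{S}_{\alpha+1}(q))$. Here $\mathcal{S}_\alpha(q)\in\mathbb Z[q]$ and $\mathcal{R}_\alpha(q)\in\mathbb Z[q,q^{ -1}]$. -}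

module Defs where

open import Data.Nat as ℕ using (ℕ; zero; suc; _∸_)
open import Data.Nat.DivMod using (_/_)
open import Data.Integer as ℤ using (ℤ; +_; -[1+_]; ∣_∣)
open import Data.Rational using (ℚ; mkℚ)
open import Data.List using (List; []; _∷_; replicate; foldr; _++_)
open import Data.Product using (_×_; _,_; proj₁; proj₂)
open import Data.Bool using (true; false)

-- Polynomials in ℤ[q], as coefficient lists (constant term first).
-- Trailing zeros are allowed; equality of polynomials is taken
-- coefficientwise (see _≈P_).

Poly : Set
Poly = List ℤ

coeff : Poly → ℕ → ℤ
coeff []       _       = + 0
coeff (c ∷ _)  zero    = c
coeff (_ ∷ cs) (suc n) = coeff cs n

_≈P_ : Poly → Poly → Set
p ≈P r = (n : ℕ) → coeff p n ≡ coeff r n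
  where open import Relation.Binary.PropositionalEquality using (_≡_)

infixl 6 _+P_ _-P_
infixl 7 _*P_ _·P_

_+P_ : Poly → Poly → Poly
[]       +P r        = r
p        +P []       = p
(a ∷ p)  +P (b ∷ r)  = (a ℤ.+ b) ∷ (p +P r)

negP : Poly → Poly
negP []      = []
negP (a ∷ p) = ℤ.- a ∷ negP p

_-P_ : Poly → Poly → Poly
p -P r = p +P negP r

_·P_ : ℤ → Poly → Poly
a ·P []      = []
a ·P (b ∷ p) = (a ℤ.* b) ∷ (a ·P p)

_*P_ : Poly → Poly → Poly
[]      *P r = []
(a ∷ p) *P r = (a ·P r) +P (+ 0 ∷ (p *P r))

constP : ℤ → Poly
constP c = c ∷ []

qpow : ℕ → Poly
qpow k = replicate k (+ 0) ++ (+ 1 ∷ [])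

qint : ℕ → Poly
qint c = replicate c (+ 1)

-- Laurent polynomials in ℤ[q,q⁻¹], represented as q^(-k) · p.

record Laurent : Set where
  constructor _⟨q⁻^_⟩
  field
    poly  : Poly
    shift : ℕ

open Laurent public

fromPoly : Poly → Laurent
fromPoly p = p ⟨q⁻^ 0 ⟩

_-LP_ : Laurent → Poly → Laurent
(p ⟨q⁻^ k ⟩) -LP s = (p -P (qpow k *P s)) ⟨q⁻^ k ⟩

q⁻¹· : Laurent → Laurent
q⁻¹· (p ⟨q⁻^ k ⟩) = p ⟨q⁻^ suc k ⟩

-- Negative continued fraction of k/d for natural numbers k > d ≥ 1:
-- k/d = c₁ - 1/(c₂ - 1/(… - 1/cₗ)), all cⱼ ≥ 2.
-- c₁ = ⌈k/d⌉ and, if c₁ ≠ k/d, the tail is the expansion of d/(c₁d - k).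
-- The denominator strictly decreases, so the fuel argument (initially d)
-- never runs out on inputs with k > d ≥ 1.

negCF-go : ℕ → ℕ → ℕ → List ℕ
negCF-go zero       k d          = []
negCF-go (suc fuel) k zero       = []
negCF-go (suc fuel) k (suc d')   with (k ℕ.+ d') / suc d'
... | c with c ℕ.* suc d' ∸ k
...   | zero    = c ∷ []
...   | suc r'  = c ∷ negCF-go fuel (suc d') (suc r')

negCF : ℕ → ℕ → List ℕ
negCF k d = negCF-go d k d

-- (R, S) = M⁻_q(c₁) ⋯ M⁻_q(cₗ) (1, 0)ᵀ,  M⁻_q(c) = ([c]_q , -q^(c-1) ; 1 , 0)

applyM : ℕ → Poly × Poly → Poly × Poly
applyM c (r , s) = ((qint c *P r) -P (qpow (c ∸ 1) *P s)) , r

RSfromCF : List ℕ → Poly × Poly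
RSfromCF cs = foldr applyM (constP (+ 1) , []) cs

RS>1 : ℕ → ℕ → Laurent × Poly
RS>1 k d = fromPoly (proj₁ (RSfromCF (negCF k d))) , proj₂ (RSfromCF (negCF k d))

-- one application of the recursion  S_α = S_{α+1},
-- R_α = q⁻¹ (R_{α+1} - S_{α+1})
stepDown : Laurent × Poly → Laurent × Poly
stepDown (r , s) = q⁻¹· (r -LP s) , s

iterate : ℕ → (Laurent × Poly → Laurent × Poly) → Laurent × Poly → Laurent × Poly
iterate zero    f x = x
iterate (suc m) f x = f (iterate m f x)

-- For α = n/d: if α > 1 use the continued fraction directly; otherwise
-- let m = ⌊(d - n)/d⌋ + 1 (the least m ≥ 1 with α + m > 1) and apply the
-- recursion m times starting from α + m = (n + m d)/d.
RS-num : ℤ → ℕ → Laurent × Poly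
RS-num n zero = fromPoly [] , []   -- unused (denominators are ≥ 1)
RS-num n (suc d') with n ℤ.≤ᵇ + suc d'
... | false = RS>1 ∣ n ∣ (suc d')
... | true  = iterate m stepDown (RS>1 ∣ n ℤ.+ + (m ℕ.* suc d') ∣ (suc d'))
  where m : ℕ
        m = suc (∣ + suc d' ℤ.- n ∣ / suc d')

RS : ℚ → Laurent × Poly
RS (mkℚ n d-1 _) = RS-num n (suc d-1)

𝓡 : ℚ → Laurent
𝓡 α = proj₁ (RS α)

𝓢 : ℚ → Poly
𝓢 α = proj₂ (RS α)

-- Gaussian integers ℤ[i], a + b i represented as (a , b).

Gauss : Set
Gauss = ℤ × ℤ

_+G_ : Gauss → Gauss → Gauss
(a , b) +G (c , d) = (a ℤ.+ c) , (b ℤ.+ d)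

i·_ : Gauss → Gauss
i· (a , b) = ℤ.- b , a

-i·_ : Gauss → Gauss
-i· (a , b) = b , ℤ.- a

evalP-i : Poly → Gauss
evalP-i []      = + 0 , + 0
evalP-i (c ∷ p) = (c , + 0) +G (i· evalP-i p)

evalL-i : Laurent → Gauss
evalL-i (p ⟨q⁻^ k ⟩) = go k
  where go : ℕ → Gauss
        go zero    = evalP-i p
        go (suc j) = -i· go j

smallGauss : List Gauss
smallGauss =
  (+ 0 , + 0) ∷
  (+ 1 , + 0) ∷ (ℤ.- + 1 , + 0) ∷
  (+ 0 , + 1) ∷ (+ 0 , ℤ.- + 1) ∷
  (+ 1 , + 1) ∷ (ℤ.- + 1 , ℤ.- + 1) ∷
  (+ 1 , ℤ.- + 1) ∷ (ℤ.- + 1 , + 1) ∷ []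

zeroPmOne : List ℤ
zeroPmOne = + 0 ∷ + 1 ∷ ℤ.- + 1 ∷ []

q²+1 : Poly
q²+1 = + 1 ∷ + 0 ∷ + 1 ∷ []

-- Evaluation at q = i is a ring homomorphism ℤ[q] → ℤ[i] sending q⁻¹ to −i.  Hence
-- (𝓡_α(i), 𝓢_α(i)) is obtained from (1, 0) by the matrices M⁻_i(c) = ([c]_i , −i^(c−1) ; 1 , 0),
-- which depend only on c mod 4, and by the recursion step (r , s) ↦ (−i (r − s) , s).  All of
-- these maps preserve the set of 24 unit multiples of (1,0), (0,1), (1,1), (1,−i), (1+i,1), (1,1−i)
-- (checked by computation), and every entry of these pairs lies in {0, ±1, ±i, ±(1+i), ±(1−i)}.  Finally
-- p ≡ p(i) modulo q² + 1 when p(i) = b + a i is read as the polynomial b + a q.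

module Submission where

open import Defs
open import Data.Bool using (true; false)
open import Data.Integer as ℤ using (ℤ; +_)
import Data.Integer.Properties as ℤ
open import Data.Integer.Tactic.RingSolver using (solve-∀)
open import Data.List using (List; []; _∷_; map; cartesianProductWith)
import Data.List.Membership.DecPropositional as DecMembership
open import Data.List.Membership.Propositional using (_∈_)
open import Data.List.Relation.Unary.All as All using (All; all?)
open import Data.List.Relation.Unary.Any using (here; there)
open import Data.Nat as ℕ using (ℕ; zero; suc; _∸_)
open import Data.Nat.DivMod using (_/_)
open import Data.Nat.Properties using (0∸n≡0)
open import Data.Product using (_×_; _,_; proj₁; proj₂; Σ-syntax)
open import Data.Product.Properties using (≡-dec)
open import Data.Rational using (ℚ; mkℚ)
open import Relation.Binary.Definitions using (DecidableEquality)
open import Relation.Binary.PropositionalEquality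
open import Relation.Nullary.Decidable using (from-yes; _×-dec_)
open ≡-Reasoning

ι : ℤ → Gauss
ι a = a , + 0

-G_ : Gauss → Gauss
-G (a , b) = ℤ.- a , ℤ.- b

_-G_ : Gauss → Gauss → Gauss
g -G h = g +G (-G h)

_*G_ : Gauss → Gauss → Gauss
(a , b) *G (c , d) = (a ℤ.* c ℤ.- b ℤ.* d) , (a ℤ.* d ℤ.+ b ℤ.* c)

+G-identityˡ : ∀ g → ι (+ 0) +G g ≡ g
+G-identityˡ (a , b) = cong₂ _,_ (ℤ.+-identityˡ a) (ℤ.+-identityˡ b)

+G-identityʳ : ∀ g → g +G ι (+ 0) ≡ g
+G-identityʳ (a , b) = cong₂ _,_ (ℤ.+-identityʳ a) (ℤ.+-identityʳ b)

-i·-distrib-+G : ∀ g h → -i· (g +G h) ≡ (-i· g) +G (-i· h)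
-i·-distrib-+G (a , b) (c , d) = cong (b ℤ.+ d ,_) (ℤ.neg-distrib-+ a c)

-i·-neg : ∀ g → -i· (-G g) ≡ -G (-i· g)
-i·-neg (a , b) = refl

-i·-inverseˡ : ∀ g → -i· (i· g) ≡ g
-i·-inverseˡ (a , b) = cong (a ,_) (ℤ.neg-involutive b)

*G-zeroˡ : ∀ g → ι (+ 0) *G g ≡ ι (+ 0)
*G-zeroˡ (a , b) = cong₂ _,_ (re a b) (im a b)
  where
  re : ∀ a b → + 0 ℤ.* a ℤ.- + 0 ℤ.* b ≡ + 0
  re = solve-∀
  im : ∀ a b → + 0 ℤ.* b ℤ.+ + 0 ℤ.* a ≡ + 0
  im = solve-∀

*G-identityˡ : ∀ g → ι (+ 1) *G g ≡ g
*G-identityˡ (a , b) = cong₂ _,_ (re a b) (im a b)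
  where
  re : ∀ a b → + 1 ℤ.* a ℤ.- + 0 ℤ.* b ≡ a
  re = solve-∀
  im : ∀ a b → + 1 ℤ.* b ℤ.+ + 0 ℤ.* a ≡ b
  im = solve-∀

*G-zeroʳ : ∀ g → g *G ι (+ 0) ≡ ι (+ 0)
*G-zeroʳ (a , b) = cong₂ _,_ (re a b) (im a b)
  where
  re : ∀ a b → a ℤ.* + 0 ℤ.- b ℤ.* + 0 ≡ + 0
  re = solve-∀
  im : ∀ a b → a ℤ.* + 0 ℤ.+ b ℤ.* + 0 ≡ + 0
  im = solve-∀

horner-+ : ∀ a b g h → ι (a ℤ.+ b) +G (i· (g +G h)) ≡ (ι a +G (i· g)) +G (ι b +G (i· h))
horner-+ a b (x , y) (u , v) = cong₂ _,_ (re a b y v) (im x u)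
  where
  re : ∀ a b y v → (a ℤ.+ b) ℤ.+ ℤ.- (y ℤ.+ v) ≡ (a ℤ.+ ℤ.- y) ℤ.+ (b ℤ.+ ℤ.- v)
  re = solve-∀
  im : ∀ x u → + 0 ℤ.+ (x ℤ.+ u) ≡ (+ 0 ℤ.+ x) ℤ.+ (+ 0 ℤ.+ u)
  im = solve-∀

horner-neg : ∀ a g → ι (ℤ.- a) +G (i· (-G g)) ≡ -G (ι a +G (i· g))
horner-neg a (x , y) = cong₂ _,_ (re a y) (im x)
  where
  re : ∀ a y → ℤ.- a ℤ.+ ℤ.- (ℤ.- y) ≡ ℤ.- (a ℤ.+ ℤ.- y)
  re = solve-∀
  im : ∀ x → + 0 ℤ.+ ℤ.- x ≡ ℤ.- (+ 0 ℤ.+ x)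
  im = solve-∀

horner-scale : ∀ a b g → ι (a ℤ.* b) +G (i· (ι a *G g)) ≡ ι a *G (ι b +G (i· g))
horner-scale a b (x , y) = cong₂ _,_ (re a b x y) (im a b x y)
  where
  re : ∀ a b x y → a ℤ.* b ℤ.+ ℤ.- (a ℤ.* y ℤ.+ + 0 ℤ.* x)
                   ≡ a ℤ.* (b ℤ.+ ℤ.- y) ℤ.- + 0 ℤ.* (+ 0 ℤ.+ x)
  re = solve-∀
  im : ∀ a b x y → + 0 ℤ.+ (a ℤ.* x ℤ.- + 0 ℤ.* y)
                   ≡ a ℤ.* (+ 0 ℤ.+ x) ℤ.+ + 0 ℤ.* (b ℤ.+ ℤ.- y)
  im = solve-∀

horner-* : ∀ a g h → (ι a *G h) +G (ι (+ 0) +G (i· (g *G h))) ≡ (ι a +G (i· g)) *G h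
horner-* a (x , y) (u , v) = cong₂ _,_ (re a x y u v) (im a x y u v)
  where
  re : ∀ a x y u v → (a ℤ.* u ℤ.- + 0 ℤ.* v) ℤ.+ (+ 0 ℤ.+ ℤ.- (x ℤ.* v ℤ.+ y ℤ.* u))
                     ≡ (a ℤ.+ ℤ.- y) ℤ.* u ℤ.- (+ 0 ℤ.+ x) ℤ.* v
  re = solve-∀
  im : ∀ a x y u v → (a ℤ.* v ℤ.+ + 0 ℤ.* u) ℤ.+ (+ 0 ℤ.+ (x ℤ.* u ℤ.- y ℤ.* v))
                     ≡ (a ℤ.+ ℤ.- y) ℤ.* v ℤ.+ (+ 0 ℤ.+ x) ℤ.* u
  im = solve-∀

evalP-i-+P : ∀ p r → evalP-i (p +P r) ≡ evalP-i p +G evalP-i r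
evalP-i-+P []      r       = sym (+G-identityˡ (evalP-i r))
evalP-i-+P (a ∷ p) []      = sym (+G-identityʳ (evalP-i (a ∷ p)))
evalP-i-+P (a ∷ p) (b ∷ r) = begin
  ι (a ℤ.+ b) +G (i· evalP-i (p +P r))       ≡⟨ cong (λ g → ι (a ℤ.+ b) +G (i· g)) (evalP-i-+P p r) ⟩
  ι (a ℤ.+ b) +G (i· (evalP-i p +G evalP-i r)) ≡⟨ horner-+ a b (evalP-i p) (evalP-i r) ⟩
  evalP-i (a ∷ p) +G evalP-i (b ∷ r)         ∎

evalP-i-negP : ∀ p → evalP-i (negP p) ≡ -G evalP-i p
evalP-i-negP []      = refl
evalP-i-negP (a ∷ p) = trans (cong (λ g → ι (ℤ.- a) +G (i· g)) (evalP-i-negP p)) (horner-neg a (evalP-i p))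

evalP-i-sub : ∀ p r → evalP-i (p -P r) ≡ evalP-i p -G evalP-i r
evalP-i-sub p r = trans (evalP-i-+P p (negP r)) (cong (evalP-i p +G_) (evalP-i-negP r))

evalP-i-·P : ∀ a p → evalP-i (a ·P p) ≡ ι a *G evalP-i p
evalP-i-·P a []      = sym (*G-zeroʳ (ι a))
evalP-i-·P a (b ∷ p) = trans (cong (λ g → ι (a ℤ.* b) +G (i· g)) (evalP-i-·P a p)) (horner-scale a b (evalP-i p))

evalP-i-*P : ∀ p r → evalP-i (p *P r) ≡ evalP-i p *G evalP-i r
evalP-i-*P []      r = sym (*G-zeroˡ (evalP-i r))
evalP-i-*P (a ∷ p) r = begin
  evalP-i ((a ·P r) +P (+ 0 ∷ (p *P r)))                ≡⟨ evalP-i-+P (a ·P r) (+ 0 ∷ (p *P r)) ⟩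
  evalP-i (a ·P r) +G (ι (+ 0) +G (i· evalP-i (p *P r)))  ≡⟨ cong₂ (λ g h → g +G (ι (+ 0) +G (i· h))) (evalP-i-·P a r) (evalP-i-*P p r) ⟩
  (ι a *G evalP-i r) +G (ι (+ 0) +G (i· (evalP-i p *G evalP-i r))) ≡⟨ horner-* a (evalP-i p) (evalP-i r) ⟩
  evalP-i (a ∷ p) *G evalP-i r ∎

-i^_·_ : ℕ → Gauss → Gauss
-i^ zero  · g = g
-i^ suc k · g = -i· (-i^ k · g)

evalL-i-⟨q⁻^⟩ : ∀ p k → evalL-i (p ⟨q⁻^ k ⟩) ≡ -i^ k · evalP-i p
evalL-i-⟨q⁻^⟩ p zero    = refl
evalL-i-⟨q⁻^⟩ p (suc k) = cong -i·_ (evalL-i-⟨q⁻^⟩ p k)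

i·-inverseˡ : ∀ g → i· (-i· g) ≡ g
i·-inverseˡ (a , b) = cong (_, b) (ℤ.neg-involutive a)

-i^-distrib-sub : ∀ k g h → -i^ k · (g -G h) ≡ (-i^ k · g) -G (-i^ k · h)
-i^-distrib-sub zero    g h = refl
-i^-distrib-sub (suc k) g h = begin
  -i· (-i^ k · (g -G h))                          ≡⟨ cong -i·_ (-i^-distrib-sub k g h) ⟩
  -i· ((-i^ k · g) -G (-i^ k · h))                ≡⟨ -i·-distrib-+G (-i^ k · g) (-G (-i^ k · h)) ⟩
  (-i^ suc k · g) +G (-i· (-G (-i^ k · h)))      ≡⟨ cong ((-i^ suc k · g) +G_) (-i·-neg (-i^ k · h)) ⟩
  (-i^ suc k · g) -G (-i^ suc k · h)              ∎

-i^-comm-i· : ∀ k g → -i^ k · (i· g) ≡ i· (-i^ k · g)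
-i^-comm-i· zero    g = refl
-i^-comm-i· (suc k) g = begin
  -i· (-i^ k · (i· g))    ≡⟨ cong -i·_ (-i^-comm-i· k g) ⟩
  -i· (i· (-i^ k · g))    ≡⟨ -i·-inverseˡ (-i^ k · g) ⟩
  -i^ k · g               ≡⟨ i·-inverseˡ (-i^ k · g) ⟨
  i· (-i^ suc k · g)      ∎

qpow-suc-*G : ∀ k e → evalP-i (qpow (suc k)) *G e ≡ i· (evalP-i (qpow k) *G e)
qpow-suc-*G k e = begin
  (ι (+ 0) +G (i· evalP-i (qpow k))) *G e                  ≡⟨ horner-* (+ 0) (evalP-i (qpow k)) e ⟨
  (ι (+ 0) *G e) +G (ι (+ 0) +G (i· (evalP-i (qpow k) *G e))) ≡⟨ cong₂ _+G_ (*G-zeroˡ e) (+G-identityˡ (i· (evalP-i (qpow k) *G e))) ⟩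
  ι (+ 0) +G (i· (evalP-i (qpow k) *G e))                 ≡⟨ +G-identityˡ (i· (evalP-i (qpow k) *G e)) ⟩
  i· (evalP-i (qpow k) *G e)                              ∎

-i^-cancel-qpow : ∀ k e → -i^ k · (evalP-i (qpow k) *G e) ≡ e
-i^-cancel-qpow zero    e = *G-identityˡ e
-i^-cancel-qpow (suc k) e = begin
  -i· (-i^ k · (evalP-i (qpow (suc k)) *G e))  ≡⟨ cong (λ g → -i· (-i^ k · g)) (qpow-suc-*G k e) ⟩
  -i· (-i^ k · (i· (evalP-i (qpow k) *G e)))   ≡⟨ cong -i·_ (-i^-comm-i· k _) ⟩
  -i· (i· (-i^ k · (evalP-i (qpow k) *G e)))   ≡⟨ -i·-inverseˡ _ ⟩
  -i^ k · (evalP-i (qpow k) *G e)              ≡⟨ -i^-cancel-qpow k e ⟩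
  e                                            ∎

evalLP-i : Laurent × Poly → Gauss × Gauss
evalLP-i (L , s) = evalL-i L , evalP-i s

stepDown-i : Gauss × Gauss → Gauss × Gauss
stepDown-i (r , s) = -i· (r -G s) , s

stepDown-at-i : ∀ x → evalLP-i (stepDown x) ≡ stepDown-i (evalLP-i x)
stepDown-at-i ((p ⟨q⁻^ k ⟩) , s) = cong (λ g → -i· g , evalP-i s) (begin
  evalL-i ((p -P (qpow k *P s)) ⟨q⁻^ k ⟩)                    ≡⟨ evalL-i-⟨q⁻^⟩ (p -P (qpow k *P s)) k ⟩
  -i^ k · evalP-i (p -P (qpow k *P s))                         ≡⟨ cong (-i^ k ·_) (evalP-i-sub p (qpow k *P s)) ⟩
  -i^ k · (evalP-i p -G evalP-i (qpow k *P s))                 ≡⟨ -i^-distrib-sub k (evalP-i p) _ ⟩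
  (-i^ k · evalP-i p) -G (-i^ k · evalP-i (qpow k *P s))       ≡⟨ cong₂ _-G_ (sym (evalL-i-⟨q⁻^⟩ p k))
                                                                     (trans (cong (-i^ k ·_) (evalP-i-*P (qpow k) s)) (-i^-cancel-qpow k (evalP-i s))) ⟩
  evalL-i (p ⟨q⁻^ k ⟩) -G evalP-i s                           ∎)

evalPP-i : Poly × Poly → Gauss × Gauss
evalPP-i (r , s) = evalP-i r , evalP-i s

entries-at-i : ℕ → Gauss × Gauss
entries-at-i c = evalP-i (qint c) , evalP-i (qpow (c ∸ 1))

actM-i : Gauss × Gauss → Gauss × Gauss → Gauss × Gauss
actM-i (x , y) (r , s) = (x *G r) -G (y *G s) , r

applyM-at-i : ∀ c rs → evalPP-i (applyM c rs) ≡ actM-i (entries-at-i c) (evalPP-i rs)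
applyM-at-i c (r , s) = cong (_, evalP-i r)
  (trans (evalP-i-sub (qint c *P r) (qpow (c ∸ 1) *P s))
         (cong₂ _-G_ (evalP-i-*P (qint c) r) (evalP-i-*P (qpow (c ∸ 1)) s)))

horner-period : ∀ a g → ι a +G (i· (ι a +G (i· (ι a +G (i· (ι a +G (i· g))))))) ≡ g
horner-period a (x , y) = cong₂ _,_ (re a x) (im a y)
  where
  re : ∀ a x → a ℤ.+ ℤ.- (+ 0 ℤ.+ (a ℤ.+ ℤ.- (+ 0 ℤ.+ x))) ≡ x
  re = solve-∀
  im : ∀ a y → + 0 ℤ.+ (a ℤ.+ ℤ.- (+ 0 ℤ.+ (a ℤ.+ ℤ.- y))) ≡ y
  im = solve-∀

entries-at-i-period : ∀ n → entries-at-i (4 ℕ.+ suc n) ≡ entries-at-i (suc n)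
entries-at-i-period n = cong₂ _,_ (horner-period (+ 1) _) (horner-period (+ 0) _)

entries-at-i-values : List (Gauss × Gauss)
entries-at-i-values = map entries-at-i (1 ∷ 2 ∷ 3 ∷ 4 ∷ [])

entries-at-i-∈ : ∀ n → entries-at-i (suc n) ∈ entries-at-i-values
entries-at-i-∈ 0 = here refl
entries-at-i-∈ 1 = there (here refl)
entries-at-i-∈ 2 = there (there (here refl))
entries-at-i-∈ 3 = there (there (there (here refl)))
entries-at-i-∈ (suc (suc (suc (suc n)))) rewrite entries-at-i-period n = entries-at-i-∈ n

units : List Gauss
units = ι (+ 1) ∷ (+ 0 , + 1) ∷ ι (ℤ.- + 1) ∷ (+ 0 , ℤ.- + 1) ∷ []

orbit-i : List (Gauss × Gauss)
orbit-i = cartesianProductWith (λ u (r , s) → u *G r , u *G s) units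
  ( (ι (+ 1) , ι (+ 0))   ∷ (ι (+ 0) , ι (+ 1))        ∷ (ι (+ 1) , ι (+ 1))
  ∷ (ι (+ 1) , (+ 0 , ℤ.- + 1)) ∷ ((+ 1 , + 1) , ι (+ 1)) ∷ (ι (+ 1) , (+ 1 , ℤ.- + 1)) ∷ [])

_≟G_ : DecidableEquality Gauss
_≟G_ = ≡-dec ℤ._≟_ ℤ._≟_

open DecMembership _≟G_ using () renaming (_∈?_ to _∈G?_)
open DecMembership (≡-dec _≟G_ _≟G_) using () renaming (_∈?_ to _∈²?_)
open DecMembership ℤ._≟_ using () renaming (_∈?_ to _∈ℤ?_)

actM-i-closed : All (λ m → All (λ rs → actM-i m rs ∈ orbit-i) orbit-i) entries-at-i-values
actM-i-closed = from-yes (all? (λ m → all? (λ rs → actM-i m rs ∈²? orbit-i) orbit-i) entries-at-i-values)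

stepDown-i-closed : All (λ rs → stepDown-i rs ∈ orbit-i) orbit-i
stepDown-i-closed = from-yes (all? (λ rs → stepDown-i rs ∈²? orbit-i) orbit-i)

orbit-i-small : All (λ (r , s) → r ∈ smallGauss × s ∈ smallGauss) orbit-i
orbit-i-small = from-yes (all? (λ (r , s) → (r ∈G? smallGauss) ×-dec (s ∈G? smallGauss)) orbit-i)

smallGauss-parts : All (λ (a , b) → a ∈ zeroPmOne × b ∈ zeroPmOne) smallGauss
smallGauss-parts = from-yes (all? (λ (a , b) → (a ∈ℤ? zeroPmOne) ×-dec (b ∈ℤ? zeroPmOne)) smallGauss)

applyM-at-i-∈ : ∀ n rs → evalPP-i rs ∈ orbit-i → evalPP-i (applyM (suc n) rs) ∈ orbit-i
applyM-at-i-∈ n rs rs∈ = subst (_∈ orbit-i) (sym (applyM-at-i (suc n) rs))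
  (All.lookup (All.lookup actM-i-closed (entries-at-i-∈ n)) rs∈)

RSfromCF-[]-at-i-∈ : evalPP-i (RSfromCF []) ∈ orbit-i
RSfromCF-[]-at-i-∈ = here refl

RSfromCF-[c]-at-i-∈ : ∀ c → evalPP-i (RSfromCF (c ∷ [])) ∈ orbit-i
RSfromCF-[c]-at-i-∈ zero    = from-yes (evalPP-i (RSfromCF (0 ∷ [])) ∈²? orbit-i)
RSfromCF-[c]-at-i-∈ (suc n) = applyM-at-i-∈ n (RSfromCF []) RSfromCF-[]-at-i-∈

-- Only the last coefficient can be 0: in the recursive branch c = 0 would give c·d ∸ k = 0.
RSfromCF-negCF-go-at-i-∈ : ∀ f k d → evalPP-i (RSfromCF (negCF-go f k d)) ∈ orbit-i
RSfromCF-negCF-go-at-i-∈ zero    k d        = RSfromCF-[]-at-i-∈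
RSfromCF-negCF-go-at-i-∈ (suc f) k zero     = RSfromCF-[]-at-i-∈
RSfromCF-negCF-go-at-i-∈ (suc f) k (suc d') with (k ℕ.+ d') / suc d'
... | c with c ℕ.* suc d' ∸ k in eq
...   | zero   = RSfromCF-[c]-at-i-∈ c
RSfromCF-negCF-go-at-i-∈ (suc f) k (suc d') | zero  | suc r' with () ← trans (sym (0∸n≡0 k)) eq
RSfromCF-negCF-go-at-i-∈ (suc f) k (suc d') | suc n | suc r' =
  applyM-at-i-∈ n _ (RSfromCF-negCF-go-at-i-∈ f (suc d') (suc r'))

iterate-stepDown-at-i-∈ : ∀ m x → evalLP-i x ∈ orbit-i → evalLP-i (iterate m stepDown x) ∈ orbit-i
iterate-stepDown-at-i-∈ zero    x x∈ = x∈
iterate-stepDown-at-i-∈ (suc m) x x∈ = subst (_∈ orbit-i) (sym (stepDown-at-i (iterate m stepDown x)))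
  (All.lookup stepDown-i-closed (iterate-stepDown-at-i-∈ m x x∈))

RS>1-at-i-∈ : ∀ k d → evalLP-i (RS>1 k d) ∈ orbit-i
RS>1-at-i-∈ k d = RSfromCF-negCF-go-at-i-∈ d k d

RS-at-i-∈ : ∀ α → evalLP-i (RS α) ∈ orbit-i
RS-at-i-∈ (mkℚ n d-1 _) with n ℤ.≤ᵇ + suc d-1
... | false = RS>1-at-i-∈ ℤ.∣ n ∣ (suc d-1)
... | true  = iterate-stepDown-at-i-∈ m (RS>1 k (suc d-1)) (RS>1-at-i-∈ k (suc d-1))
  where
  m : ℕ
  m = suc (ℤ.∣ + suc d-1 ℤ.- n ∣ / suc d-1)
  k : ℕ
  k = ℤ.∣ n ℤ.+ + (m ℕ.* suc d-1) ∣

coeff-+P : ∀ p r n → coeff (p +P r) n ≡ coeff p n ℤ.+ coeff r n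
coeff-+P []      r       n       = sym (ℤ.+-identityˡ (coeff r n))
coeff-+P (a ∷ p) []      n       = sym (ℤ.+-identityʳ (coeff (a ∷ p) n))
coeff-+P (a ∷ p) (b ∷ r) zero    = refl
coeff-+P (a ∷ p) (b ∷ r) (suc n) = coeff-+P p r n

coeff-·P : ∀ a p n → coeff (a ·P p) n ≡ a ℤ.* coeff p n
coeff-·P a []      n       = sym (ℤ.*-zeroʳ a)
coeff-·P a (b ∷ p) zero    = refl
coeff-·P a (b ∷ p) (suc n) = coeff-·P a p n

coeff-∷*P : ∀ a p r n → coeff ((a ∷ p) *P r) n ≡ a ℤ.* coeff r n ℤ.+ coeff (+ 0 ∷ (p *P r)) n
coeff-∷*P a p r n = trans (coeff-+P (a ·P r) (+ 0 ∷ (p *P r)) n) (cong (ℤ._+ coeff (+ 0 ∷ (p *P r)) n) (coeff-·P a r n))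

coeff-q²+1*P : ∀ Q n → coeff (q²+1 *P Q) n ≡ coeff Q n ℤ.+ coeff (+ 0 ∷ + 0 ∷ Q) n
coeff-q²+1*P Q n = trans (coeff-∷*P (+ 1) (+ 0 ∷ + 1 ∷ []) Q n)
                         (cong₂ ℤ._+_ (ℤ.*-identityˡ (coeff Q n)) (shifted n))
  where
  shifted : ∀ n → coeff (+ 0 ∷ ((+ 0 ∷ + 1 ∷ []) *P Q)) n ≡ coeff (+ 0 ∷ + 0 ∷ Q) n
  shifted zero          = refl
  shifted (suc zero)    = trans (coeff-∷*P (+ 0) (+ 1 ∷ []) Q 0) (lemma (coeff Q 0))
    where lemma : ∀ x → + 0 ℤ.* x ℤ.+ + 0 ≡ + 0
          lemma = solve-∀
  shifted (suc (suc m)) = begin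
    coeff ((+ 0 ∷ + 1 ∷ []) *P Q) (suc m)                              ≡⟨ coeff-∷*P (+ 0) (+ 1 ∷ []) Q (suc m) ⟩
    + 0 ℤ.* coeff Q (suc m) ℤ.+ coeff ((+ 1 ∷ []) *P Q) m                ≡⟨ cong (λ z → + 0 ℤ.* coeff Q (suc m) ℤ.+ z) (coeff-∷*P (+ 1) [] Q m) ⟩
    + 0 ℤ.* coeff Q (suc m) ℤ.+ (+ 1 ℤ.* coeff Q m ℤ.+ coeff (+ 0 ∷ []) m) ≡⟨ cong (λ z → + 0 ℤ.* coeff Q (suc m) ℤ.+ (+ 1 ℤ.* coeff Q m ℤ.+ z)) (coeff-0∷[] m) ⟩
    + 0 ℤ.* coeff Q (suc m) ℤ.+ (+ 1 ℤ.* coeff Q m ℤ.+ + 0)             ≡⟨ lemma (coeff Q (suc m)) (coeff Q m) ⟩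
    coeff Q m                                                            ∎
    where
    lemma : ∀ x y → + 0 ℤ.* x ℤ.+ (+ 1 ℤ.* y ℤ.+ + 0) ≡ y
    lemma = solve-∀
    coeff-0∷[] : ∀ m → coeff (+ 0 ∷ []) m ≡ + 0
    coeff-0∷[] zero    = refl
    coeff-0∷[] (suc m) = refl

quot-q²+1 : Poly → Poly
quot-q²+1 []      = []
quot-q²+1 (c ∷ p) = proj₂ (evalP-i p) ∷ quot-q²+1 p

rem-q²+1 : Poly → Poly
rem-q²+1 p = proj₁ (evalP-i p) ∷ proj₂ (evalP-i p) ∷ []

-- If p = (q²+1) Q + b + a q, then c + q p = (q²+1) (a + q Q) + (c − a) + b q.
q²+1-division-coeff : ∀ p n → coeff p n ≡ (coeff (quot-q²+1 p) n ℤ.+ coeff (+ 0 ∷ + 0 ∷ quot-q²+1 p) n) ℤ.+ coeff (rem-q²+1 p) n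
q²+1-division-coeff []      zero                = refl
q²+1-division-coeff []      (suc zero)          = refl
q²+1-division-coeff []      (suc (suc n))       = refl
q²+1-division-coeff (c ∷ p) zero                = lemma c (proj₂ (evalP-i p))
  where lemma : ∀ c a → c ≡ (a ℤ.+ + 0) ℤ.+ (c ℤ.+ ℤ.- a)
        lemma = solve-∀
q²+1-division-coeff (c ∷ p) (suc zero)          =
  trans (q²+1-division-coeff p 0) (lemma (coeff (quot-q²+1 p) 0) (proj₁ (evalP-i p)))
  where lemma : ∀ x b → (x ℤ.+ + 0) ℤ.+ b ≡ (x ℤ.+ + 0) ℤ.+ (+ 0 ℤ.+ b)
        lemma = solve-∀
q²+1-division-coeff (c ∷ p) (suc (suc zero))    =
  trans (q²+1-division-coeff p 1) (lemma (coeff (quot-q²+1 p) 1) (proj₂ (evalP-i p)))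
  where lemma : ∀ x a → (x ℤ.+ + 0) ℤ.+ a ≡ (x ℤ.+ a) ℤ.+ + 0
        lemma = solve-∀
q²+1-division-coeff (c ∷ p) (suc (suc (suc n))) = q²+1-division-coeff p (suc (suc n))

q²+1-division : ∀ p → p ≈P ((q²+1 *P quot-q²+1 p) +P rem-q²+1 p)
q²+1-division p n = begin
  coeff p n                                                          ≡⟨ q²+1-division-coeff p n ⟩
  (coeff Q n ℤ.+ coeff (+ 0 ∷ + 0 ∷ Q) n) ℤ.+ coeff (rem-q²+1 p) n   ≡⟨ cong (ℤ._+ coeff (rem-q²+1 p) n) (coeff-q²+1*P Q n) ⟨
  coeff (q²+1 *P Q) n ℤ.+ coeff (rem-q²+1 p) n                        ≡⟨ coeff-+P (q²+1 *P Q) (rem-q²+1 p) n ⟨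
  coeff ((q²+1 *P Q) +P rem-q²+1 p) n                                ∎
  where Q = quot-q²+1 p

proposition7p5 : (α : ℚ) →
    evalL-i (𝓡 α) ∈ smallGauss
    × evalP-i (𝓢 α) ∈ smallGauss
    × (Σ[ Q ∈ Poly ] Σ[ a ∈ ℤ ] Σ[ b ∈ ℤ ]
        (a ∈ zeroPmOne × b ∈ zeroPmOne
         × 𝓢 α ≈P ((q²+1 *P Q) +P (b ∷ a ∷ []))))
proposition7p5 α =
  R∈ , S∈ , quot-q²+1 (𝓢 α) , proj₂ (evalP-i (𝓢 α)) , proj₁ (evalP-i (𝓢 α)) , a∈ , b∈ , q²+1-division (𝓢 α)
  where
  values-small = All.lookup orbit-i-small (RS-at-i-∈ α)
  R∈ = proj₁ values-small
  S∈ = proj₂ values-small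
  b∈ = proj₁ (All.lookup smallGauss-parts S∈)
  a∈ = proj₂ (All.lookup smallGauss-parts S∈)
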